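{- Let $C_n$ be a chordless cycle with $n\ge 4$, and consider an IP-SEG* model of $C_n$ not consisting exclusively of permutation segments. Then this model has exactly one interval arc.
   Context: Let $L_1$ and $L_2$ be the horizontal lines $y=1$ and $y=2$. An interval segment is a segment with both endpoints on the same $L_i$; a permutation segment has one endpoint on $L_1$ and the other on $L_2$. An IP-SEG model of a graph assigns to each vertex an interval or permutation segment so that two distinct vertices are adjacent iff their segments intersect; it is an IP-SEG* model if all its interval segments lie on the same line $L_i$. For a chordless cycle $C_n=(v_1,\dots,v_n)$ with a model containing both interval and permutation segments, with $s(v_i)$ the segment of $v_i$, an interval arc is a maximal sequence $(s(v_i),\dots,s(v_j))$ of segments of consecutive cycle vertices (indices modulo $n$) that are all interval segments, so that $s(v_{i-1})$ and $s(v_{j+1})$ are permutation segments. -}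

module Defs where

open import Level using (Level; Lift; _⊔_)
open import Data.Nat using (ℕ; suc; _+_; _∸_; _≤_; _<_; _%_; NonZero)
open import Data.Nat.DivMod using (m%n<n)
open import Data.Fin using (Fin; toℕ; fromℕ<)
open import Data.Product using (Σ; ∃; _×_)
open import Data.Sum using (_⊎_)
open import Data.Unit using (⊤)
open import Data.Empty using (⊥)
open import Relation.Binary.Bundles using (TotalOrder)
open import Relation.Binary.PropositionalEquality using (_≡_; _≢_)
open import Function.Bundles using (_⇔_)

-- The two horizontal lines L₁ (y = 1) and L₂ (y = 2).
data Line : Set where
  L₁ L₂ : Line

at : (n : ℕ) → .{{_ : NonZero n}} → ℕ → Fin n
at n m = fromℕ< (m%n<n m n)

CycleAdj : (n : ℕ) → .{{_ : NonZero n}} → Fin n → Fin n → Set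
CycleAdj n i j = (j ≡ at n (suc (toℕ i))) ⊎ (i ≡ at n (suc (toℕ j)))

-- Segments, with x-coordinates taken in an arbitrary total order
-- (e.g. the reals); only the order of the coordinates matters.
module _ {c ℓ₁ ℓ₂ : Level} (O : TotalOrder c ℓ₁ ℓ₂) where
  open TotalOrder O renaming (Carrier to A; _≤_ to _≤ₒ_)

  data Seg : Set (c ⊔ ℓ₂) where
    ival : (l : Line) (a b : A) → a ≤ₒ b → Seg
    -- permutation segment from (x, 1) on L₁ to (y, 2) on L₂
    perm : (x y : A) → Seg

  IsInterval : Seg → Set
  IsInterval (ival _ _ _ _) = ⊤
  IsInterval (perm _ _)     = ⊥

  IsPermutation : Seg → Set
  IsPermutation (ival _ _ _ _) = ⊥
  IsPermutation (perm _ _)     = ⊤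

  Intersect : Seg → Seg → Set ℓ₂
  Intersect (ival L₁ a b _) (ival L₁ c d _) = (c ≤ₒ b) × (a ≤ₒ d)
  Intersect (ival L₂ a b _) (ival L₂ c d _) = (c ≤ₒ b) × (a ≤ₒ d)
  Intersect (ival L₁ _ _ _) (ival L₂ _ _ _) = Lift ℓ₂ ⊥
  Intersect (ival L₂ _ _ _) (ival L₁ _ _ _) = Lift ℓ₂ ⊥
  Intersect (ival L₁ a b _) (perm x y) = (a ≤ₒ x) × (x ≤ₒ b)
  Intersect (ival L₂ a b _) (perm x y) = (a ≤ₒ y) × (y ≤ₒ b)
  Intersect (perm x y) (ival L₁ a b _) = (a ≤ₒ x) × (x ≤ₒ b)
  Intersect (perm x y) (ival L₂ a b _) = (a ≤ₒ y) × (y ≤ₒ b)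
  Intersect (perm x₁ y₁) (perm x₂ y₂) =
    ((x₁ ≤ₒ x₂) × (y₂ ≤ₒ y₁)) ⊎ ((x₂ ≤ₒ x₁) × (y₁ ≤ₒ y₂))

  IsCycleModel : (n : ℕ) → .{{_ : NonZero n}} → (Fin n → Seg) → Set ℓ₂
  IsCycleModel n s = ∀ i j → i ≢ j → (Intersect (s i) (s j) ⇔ CycleAdj n i j)

  OnLineOrPerm : Line → Seg → Set
  OnLineOrPerm l (ival l' _ _ _) = l ≡ l'
  OnLineOrPerm l (perm _ _)      = ⊤

  IsStar : (n : ℕ) → (Fin n → Seg) → Set
  IsStar n s = ∃ λ l → ∀ i → OnLineOrPerm l (s i)

  record IntervalArc (n : ℕ) .{{_ : NonZero n}} (s : Fin n → Seg) : Set where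
    field
      start  : Fin n
      len    : ℕ
      nonempty : 1 ≤ len
      inner  : ∀ m → m < len → IsInterval (s (at n (toℕ start + m)))
      before : IsPermutation (s (at n (toℕ start + (n ∸ 1))))
      after  : IsPermutation (s (at n (toℕ start + len)))

  open IntervalArc public

  ExactlyOneArc : (n : ℕ) → .{{_ : NonZero n}} → (Fin n → Seg) → Set
  ExactlyOneArc n s =
    Σ (IntervalArc n s) λ a →
      ∀ (b : IntervalArc n s) → (start b ≡ start a) × (len b ≡ len a)

module Submission where

-- The geometric core (`Geometry`) is a side argument: a segment
-- disjoint from a pivot lies strictly on one side of it, and a walk along the cycle
-- avoiding the pivot never changes side. It gives three facts about such cycles
-- (`CycleProperties`): no permutation segment lies between two interval neighbours,
-- not all segments are intervals, and an interval arc leaves at most four positions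
-- to the rest of the cycle. Together they force every position outside an arc to hold
-- a permutation segment (`arcComplement₀`), from which existence and uniqueness of the
-- arc follow (`Arcs`) by two discrete intermediate-value arguments and a renumbering
-- of the cycle.

open import Defs
open import Level using (Level; _⊔_)
open import Data.Nat
  using (ℕ; zero; suc; _+_; _∸_; _≤_; _<_; _%_; NonZero; z≤n; z<s; s≤s; s≤s⁻¹; _≤?_; _<?_;
         _≤′_; ≤′-refl; ≤′-step)
open import Data.Nat.DivMod
open import Data.Nat.Properties
open import Data.Fin using (Fin; toℕ; fromℕ<)
open import Data.Fin.Properties using (¬∀⟶∃¬; toℕ-fromℕ<; toℕ<n; toℕ-injective)
open import Data.Product using (∃; _×_; _,_; proj₁; proj₂) renaming (swap to ×-swap)
open import Data.Sum using (_⊎_; inj₁; inj₂; swap; [_,_]′)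
import Data.Sum as Sum
open import Data.Empty using (⊥; ⊥-elim)
open import Data.Unit using (⊤; tt)
open import Relation.Nullary using (¬_; Dec; yes; no)
open import Relation.Binary.Bundles using (TotalOrder)
open import Relation.Binary.PropositionalEquality
open import Relation.Binary.Definitions using (tri<; tri≈; tri>)
open import Function using (_∘_; id)
open import Function.Bundles using (_⇔_; mk⇔; Equivalence)

module _ {ℓ} {Q : ℕ → Set ℓ} (Q? : ∀ n → Dec (Q n)) where

  transition : ∀ {a b} → ¬ Q a → Q b → a ≤ b → ∃ λ j → ¬ Q j × Q (suc j)
  transition {b = zero} ¬qa qb a≤0 rewrite n≤0⇒n≡0 a≤0 = ⊥-elim (¬qa qb)
  transition {b = suc b} ¬qa qb a≤b with Q? b | m≤n⇒m<n∨m≡n a≤b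
  ... | no ¬qb | _          = b , ¬qb , qb
  ... | yes q  | inj₁ a<1+b = transition ¬qa q (s≤s⁻¹ a<1+b)
  ... | yes _  | inj₂ refl  = ⊥-elim (¬qa qb)

  longestRun : ∀ {a} d → Q a → ¬ Q (a + d) →
               ∃ λ l → 1 ≤ l × (∀ m → m < l → Q (a + m)) × ¬ Q (a + l)
  longestRun {a} zero qa ¬q = ⊥-elim (¬q (subst Q (sym (+-identityʳ a)) qa))
  longestRun {a} (suc d) qa ¬q =
    extend d 1 ≤-refl first (subst (λ k → ¬ Q (a + k)) (+-comm 1 d) ¬q)
    where
    first : ∀ m → m < 1 → Q (a + m)
    first zero _ = subst Q (sym (+-identityʳ a)) qa
    first (suc _) (s≤s ())

    extend : ∀ e k → 1 ≤ k → (∀ m → m < k → Q (a + m)) → ¬ Q (a + (e + k)) →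
             ∃ λ l → 1 ≤ l × (∀ m → m < l → Q (a + m)) × ¬ Q (a + l)
    extend e k k≥1 run ¬q′ with Q? (a + k)
    ... | no ¬qk = k , k≥1 , run , ¬qk
    ... | yes qk with e
    ...   | zero   = ⊥-elim (¬q′ qk)
    ...   | suc e′ = extend e′ (suc k) (m≤n⇒m≤1+n k≥1) run′
                       (subst (λ i → ¬ Q (a + i)) (sym (+-suc e′ k)) ¬q′)
      where
      run′ : ∀ m → m < suc k → Q (a + m)
      run′ m m<1+k with m≤n⇒m<n∨m≡n (s≤s⁻¹ m<1+k)
      ... | inj₁ m<k  = run m m<k
      ... | inj₂ refl = qk

cyclicOffset : ∀ {N a b} → a < N → b < N → ∃ λ d → d < N × (a + d ≡ b ⊎ a + d ≡ b + N)
cyclicOffset {N} {a} {b} a<N b<N with a ≤? b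
... | yes a≤b = b ∸ a , ≤-<-trans (m∸n≤m b a) b<N , inj₁ (m+[n∸m]≡n a≤b)
... | no a≰b  = (b + N) ∸ a , d<N , inj₂ (m+[n∸m]≡n a≤b+N)
  where
  a≤b+N : a ≤ b + N
  a≤b+N = ≤-trans (<⇒≤ a<N) (m≤n+m N b)
  d<N : (b + N) ∸ a < N
  d<N = +-cancelˡ-< a _ _ (subst (_< a + N) (sym (m+[n∸m]≡n a≤b+N)) (+-monoˡ-< N (≰⇒> a≰b)))

-- Segment geometry, after a reflection has put every interval segment on L₁.
-- Coordinates live in an arbitrary total order.
module Geometry {c ℓ₁ ℓ₂ : Level} (O : TotalOrder c ℓ₁ ℓ₂) where
  open TotalOrder O
    renaming (Carrier to A; _≤_ to _≼_; refl to ≼-refl; trans to ≼-trans)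
    using (total)
  import Relation.Binary.Properties.TotalOrder O as TotalOrderProperties

  _≺_ : A → A → Set ℓ₂
  x ≺ y = ¬ (y ≼ x)

  ≺⇒≼ : ∀ {x y} → x ≺ y → x ≼ y
  ≺⇒≼ = TotalOrderProperties.≰⇒≥

  data NSeg : Set (c ⊔ ℓ₂) where
    ivl : (a b : A) → a ≼ b → NSeg
    prm : (x y : A) → NSeg

  IsIvl IsPrm : NSeg → Set
  IsIvl (ivl _ _ _) = ⊤
  IsIvl (prm _ _)   = ⊥
  IsPrm (ivl _ _ _) = ⊥
  IsPrm (prm _ _)   = ⊤

  isIvl? : ∀ w → Dec (IsIvl w)
  isIvl? (ivl _ _ _) = yes tt
  isIvl? (prm _ _)   = no λ ()

  ¬ivl⇒prm : ∀ w → ¬ IsIvl w → IsPrm w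
  ¬ivl⇒prm (ivl _ _ _) ¬i = ¬i tt
  ¬ivl⇒prm (prm _ _)   _  = tt

  ivl-prm-disjoint : ∀ w → IsIvl w → IsPrm w → ⊥
  ivl-prm-disjoint (ivl _ _ _) _ ()

  Meets : NSeg → NSeg → Set ℓ₂
  Meets (ivl a b _) (ivl c d _) = (c ≼ b) × (a ≼ d)
  Meets (ivl a b _) (prm x _)   = (a ≼ x) × (x ≼ b)
  Meets (prm x _)   (ivl a b _) = (a ≼ x) × (x ≼ b)
  Meets (prm x y)   (prm x′ y′) = ((x ≼ x′) × (y′ ≼ y)) ⊎ ((x′ ≼ x) × (y ≼ y′))

  Meets-sym : ∀ w w′ → Meets w w′ → Meets w′ w
  Meets-sym (ivl _ _ _) (ivl _ _ _) (p , q) = q , p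
  Meets-sym (ivl _ _ _) (prm _ _)   m       = m
  Meets-sym (prm _ _)   (ivl _ _ _) m       = m
  Meets-sym (prm _ _)   (prm _ _)   m       = swap m

  Traces : NSeg → A → Set ℓ₂
  Traces (ivl a b _) x = (a ≼ x) × (x ≼ b)
  Traces (prm u _)   x = (u ≼ x) × (x ≼ u)

  common-point : ∀ w w′ {x} → Traces w x → Traces w′ x → Meets w w′
  common-point (ivl _ _ _) (ivl _ _ _) (a≼x , x≼b) (c≼x , x≼d) = ≼-trans c≼x x≼b , ≼-trans a≼x x≼d
  common-point (ivl _ _ _) (prm _ _)   (a≼x , x≼b) (u≼x , x≼u) = ≼-trans a≼x x≼u , ≼-trans u≼x x≼b
  common-point (prm _ _)   (ivl _ _ _) (u≼x , x≼u) (a≼x , x≼b) = ≼-trans a≼x x≼u , ≼-trans u≼x x≼b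
  common-point (prm _ y)   (prm _ y′)  (u≼x , x≼u) (u′≼x , x≼u′) with total y y′
  ... | inj₁ y≼y′ = inj₂ (≼-trans u′≼x x≼u , y≼y′)
  ... | inj₂ y′≼y = inj₁ (≼-trans u≼x x≼u′ , y′≼y)

  ivl-prm-ivl : ∀ u v w → IsIvl u → IsPrm v → IsIvl w → Meets u v → Meets v w → Meets u w
  ivl-prm-ivl u@(ivl _ _ _) (prm _ _) w@(ivl _ _ _) _ _ _ uv vw = common-point u w uv vw

  Left : NSeg → NSeg → Set ℓ₂
  Left (ivl _ b _) (ivl c _ _) = b ≺ c
  Left (ivl _ b _) (prm x _)   = b ≺ x
  Left (prm x _)   (ivl c _ _) = x ≺ c
  Left (prm x y)   (prm x′ y′) = (x ≺ x′) × (y ≺ y′)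

  separate : ∀ w p → ¬ Meets w p → Left w p ⊎ Left p w
  separate (ivl a b a≼b) (ivl c d c≼d) ¬m with total c b
  ... | inj₁ c≼b = inj₂ λ a≼d → ¬m (c≼b , a≼d)
  ... | inj₂ b≼c = inj₁ λ c≼b → ¬m (c≼b , ≼-trans a≼b (≼-trans b≼c c≼d))
  separate (ivl a b a≼b) (prm x _) ¬m with total x b
  ... | inj₁ x≼b = inj₂ λ a≼x → ¬m (a≼x , x≼b)
  ... | inj₂ b≼x = inj₁ λ x≼b → ¬m (≼-trans a≼b b≼x , x≼b)
  separate (prm x y) (ivl a b a≼b) ¬m = swap (separate (ivl a b a≼b) (prm x y) ¬m)
  separate (prm x y) (prm x′ y′) ¬m with total x x′
  ... | inj₁ x≼x′ = inj₁ ((λ x′≼x → ¬m (inj₂ (x′≼x , ≺⇒≼ y≺y′))) , y≺y′)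
    where y≺y′ = λ y′≼y → ¬m (inj₁ (x≼x′ , y′≼y))
  ... | inj₂ x′≼x = inj₂ ((λ x≼x′ → ¬m (inj₁ (x≼x′ , ≺⇒≼ y′≺y))) , y′≺y)
    where y′≺y = λ y≼y′ → ¬m (inj₂ (x′≼x , y≼y′))

  Left⇒¬Meets : ∀ w p → Left w p → ¬ Meets w p
  Left⇒¬Meets (ivl _ _ _) (ivl _ _ _) b≺c       (c≼b , _)       = b≺c c≼b
  Left⇒¬Meets (ivl _ _ _) (prm _ _)   b≺x       (_ , x≼b)       = b≺x x≼b
  Left⇒¬Meets (prm _ _)   (ivl _ _ _) x≺a       (a≼x , _)       = x≺a a≼x
  Left⇒¬Meets (prm _ _)   (prm _ _)   (_ , y≺y′) (inj₁ (_ , y′≼y)) = y≺y′ y′≼y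
  Left⇒¬Meets (prm _ _)   (prm _ _)   (x≺x′ , _) (inj₂ (x′≼x , _)) = x≺x′ x′≼x

  Left-asym : ∀ w p → Left w p → Left p w → ⊥
  Left-asym (ivl a b a≼b) (ivl c d c≼d) b≺c d≺a = b≺c (≼-trans c≼d (≼-trans (≺⇒≼ d≺a) a≼b))
  Left-asym (ivl a b a≼b) (prm x _)     b≺x x≺a = b≺x (≼-trans (≺⇒≼ x≺a) a≼b)
  Left-asym (prm x _)     (ivl a b a≼b) x≺a b≺x = b≺x (≼-trans (≺⇒≼ x≺a) a≼b)
  Left-asym (prm _ _)     (prm _ _)     (x≺x′ , _) (x′≺x , _) = x≺x′ (≺⇒≼ x′≺x)

  cross : ∀ w w′ p → IsPrm p ⊎ (IsIvl w × IsIvl w′) → Meets w w′ → Left w p → Left p w′ → ⊥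
  cross (ivl _ _ _) (ivl _ _ _) (prm _ _) _ (c≼b , _) b≺x x≺c = b≺x (≼-trans (≺⇒≼ x≺c) c≼b)
  cross (ivl _ _ _) (prm _ _)   (prm _ _) _ (_ , u≼b) b≺x (x≺u , _) = b≺x (≼-trans (≺⇒≼ x≺u) u≼b)
  cross (prm _ _)   (ivl _ _ _) (prm _ _) _ (c≼u , _) (u≺x , _) x≺c = u≺x (≼-trans (≺⇒≼ x≺c) c≼u)
  cross (prm _ _)   (prm _ _)   (prm _ _) _ (inj₁ (_ , v′≼v)) (_ , v≺y) (_ , y≺v′) =
    v≺y (≼-trans (≺⇒≼ y≺v′) v′≼v)
  cross (prm _ _)   (prm _ _)   (prm _ _) _ (inj₂ (u′≼u , _)) (u≺x , _) (x≺u′ , _) =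
    u≺x (≼-trans (≺⇒≼ x≺u′) u′≼u)
  cross (ivl _ _ _) (ivl _ _ _) (ivl a b a≼b) _ (e≼d , _) d≺a b≺e =
    d≺a (≼-trans a≼b (≼-trans (≺⇒≼ b≺e) e≼d))
  cross (ivl _ _ _) (prm _ _)   (ivl _ _ _) (inj₂ (_ , ())) _ _ _
  cross (prm _ _)   _           (ivl _ _ _) (inj₂ (() , _)) _ _ _

  Left-trans : ∀ w q p → IsIvl w ⊎ IsIvl p → Left w q → Left q p → Left w p
  Left-trans (ivl _ _ _) (ivl _ _ e≼f) (ivl _ _ _) _ b≺e f≺g g≼b = b≺e (≼-trans e≼f (≼-trans (≺⇒≼ f≺g) g≼b))
  Left-trans (ivl _ _ _) (ivl _ _ e≼f) (prm _ _)   _ b≺e f≺x x≼b = b≺e (≼-trans e≼f (≼-trans (≺⇒≼ f≺x) x≼b))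
  Left-trans (ivl _ _ _) (prm _ _)     (ivl _ _ _) _ b≺u u≺g g≼b = b≺u (≼-trans (≺⇒≼ u≺g) g≼b)
  Left-trans (ivl _ _ _) (prm _ _)     (prm _ _)   _ b≺u (u≺x , _) x≼b = b≺u (≼-trans (≺⇒≼ u≺x) x≼b)
  Left-trans (prm _ _)   (ivl _ _ e≼f) (ivl _ _ _) _ s≺e f≺g g≼s = s≺e (≼-trans e≼f (≼-trans (≺⇒≼ f≺g) g≼s))
  Left-trans (prm _ _)   (prm _ _)     (ivl _ _ _) _ (s≺u , _) u≺g g≼s = s≺u (≼-trans (≺⇒≼ u≺g) g≼s)
  Left-trans (prm _ _)   _             (prm _ _)   (inj₁ ()) _ _
  Left-trans (prm _ _)   _             (prm _ _)   (inj₂ ()) _ _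

  data Side : Set where
    left right : Side

  flip : Side → Side
  flip left  = right
  flip right = left

  On : Side → NSeg → NSeg → Set ℓ₂
  On left  w p = Left w p
  On right w p = Left p w

  On-swap : ∀ σ {w p} → On σ w p → On (flip σ) p w
  On-swap left  h = h
  On-swap right h = h

  On-swap⁻ : ∀ σ {w p} → On (flip σ) w p → On σ p w
  On-swap⁻ left  h = h
  On-swap⁻ right h = h

  separateOn : ∀ σ w p → ¬ Meets w p → On σ w p ⊎ On (flip σ) w p
  separateOn left  w p ¬m = separate w p ¬m
  separateOn right w p ¬m = swap (separate w p ¬m)

  On-asym : ∀ σ w p → On σ w p → On (flip σ) w p → ⊥
  On-asym left  w p l r = Left-asym w p l r
  On-asym right w p r l = Left-asym w p l r

  On⇒¬Meets : ∀ σ w p → On σ w p → ¬ Meets w p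
  On⇒¬Meets left  w p h m = Left⇒¬Meets w p h m
  On⇒¬Meets right w p h m = Left⇒¬Meets p w h (Meets-sym w p m)

  crossOn : ∀ σ w w′ p → IsPrm p ⊎ (IsIvl w × IsIvl w′) →
            Meets w w′ → On σ w p → On (flip σ) w′ p → ⊥
  crossOn left  w w′ p ok m l r = cross w w′ p ok m l r
  crossOn right w w′ p ok m r l =
    cross w′ w p (Sum.map₂ ×-swap ok) (Meets-sym w w′ m) l r

  On-trans : ∀ σ w q p → IsIvl w → On σ w q → On σ q p → On σ w p
  On-trans left  w q p iw wq qp = Left-trans w q p (inj₁ iw) wq qp
  On-trans right w q p iw qw pq = Left-trans p q w (inj₂ iw) pq qw

  edge : Side → NSeg → A
  edge left  (ivl a _ _) = a
  edge right (ivl _ b _) = b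
  edge _     (prm x _)   = x

  meets-edge : ∀ σ w z p → IsIvl w → Meets w p → Meets w z → On σ z p → Traces w (edge σ p)
  meets-edge left  (ivl _ _ _) _           (prm _ _)   _ wp _ _ = wp
  meets-edge right (ivl _ _ _) _           (prm _ _)   _ wp _ _ = wp
  meets-edge left  (ivl _ _ _) (ivl _ _ _) (ivl _ _ _) _ (a≼f , _) (_ , e≼h) h≺a = ≼-trans e≼h (≺⇒≼ h≺a) , a≼f
  meets-edge left  (ivl _ _ _) (prm _ _)   (ivl _ _ _) _ (a≼f , _) (e≼u , _) u≺a = ≼-trans e≼u (≺⇒≼ u≺a) , a≼f
  meets-edge right (ivl _ _ _) (ivl _ _ _) (ivl _ _ _) _ (_ , e≼b) (g≼f , _) b≺g = e≼b , ≼-trans (≺⇒≼ b≺g) g≼f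
  meets-edge right (ivl _ _ _) (prm _ _)   (ivl _ _ _) _ (_ , e≼b) (_ , u≼f) b≺u = e≼b , ≼-trans (≺⇒≼ b≺u) u≼f

  -- T lists the segments of a model of the chordless cycle of length 4 + o,
  -- the index of each vertex being taken modulo 4 + o.
  record IsCycle (o : ℕ) (T : ℕ → NSeg) : Set (c ⊔ ℓ₂) where
    field
      periodic : ∀ m → T (m + (4 + o)) ≡ T m
      adjacent : ∀ m → Meets (T m) (T (suc m))
      distant  : ∀ {i j} → i + 2 ≤ j → j + 2 ≤ i + (4 + o) → ¬ Meets (T i) (T j)

  shift : ∀ {o T} → IsCycle o T → ∀ d → IsCycle o (λ m → T (d + m))
  shift {o} {T} C d = record
    { periodic = λ m → trans (cong T (sym (+-assoc d m (4 + o)))) (periodic (d + m))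
    ; adjacent = λ m → subst (λ k → Meets (T (d + m)) (T k)) (sym (+-suc d m)) (adjacent (d + m))
    ; distant  = λ {i} {j} i+2≤j j+2≤i+N →
        distant (subst (_≤ d + j) (sym (+-assoc d i 2)) (+-monoʳ-≤ d i+2≤j))
                (subst₂ _≤_ (sym (+-assoc d j 2)) (sym (+-assoc d i (4 + o))) (+-monoʳ-≤ d j+2≤i+N))
    }
    where open IsCycle C

  -- An interval arc (T(st), ..., T(st + l - 1)) of a cycle of length 4 + o: its
  -- neighbours T(st - 1) = T(st + 3 + o) and T(st + l) are permutation segments.
  record Arc (o : ℕ) (T : ℕ → NSeg) (st l : ℕ) : Set where
    field
      arc-nonempty : 1 ≤ l
      arc-inner    : ∀ m → m < l → IsIvl (T (st + m))
      arc-before   : IsPrm (T (st + (3 + o)))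
      arc-after    : IsPrm (T (st + l))

  open Arc

  Arc-transport : ∀ {o T T′ s s′ l} → (∀ m → T (s + m) ≡ T′ (s′ + m)) → Arc o T s l → Arc o T′ s′ l
  Arc-transport {o} {l = l} eq a = record
    { arc-nonempty = arc-nonempty a
    ; arc-inner    = λ m m<l → subst IsIvl (eq m) (arc-inner a m m<l)
    ; arc-before   = subst IsPrm (eq (3 + o)) (arc-before a)
    ; arc-after    = subst IsPrm (eq l) (arc-after a)
    }

  Arc-length : ∀ {o T s la lb} → Arc o T s la → Arc o T s lb → la ≡ lb
  Arc-length {la = la} {lb = lb} a b with <-cmp la lb
  ... | tri< la<lb _ _ = ⊥-elim (ivl-prm-disjoint _ (arc-inner b la la<lb) (arc-after a))
  ... | tri≈ _ la≡lb _ = la≡lb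
  ... | tri> _ _ lb<la = ⊥-elim (ivl-prm-disjoint _ (arc-inner a lb lb<la) (arc-after b))

  module CycleProperties {o} {T : ℕ → NSeg} (C : IsCycle o T) where
    open IsCycle C

    distant′ : ∀ {i j} → i + 2 ≤ j → j + 2 ≤ i + (4 + o) → ¬ Meets (T j) (T i)
    distant′ i+2≤j j+2≤i+N m = distant i+2≤j j+2≤i+N (Meets-sym _ _ m)

    closing : Meets (T (3 + o)) (T 0)
    closing = subst (Meets (T (3 + o))) (periodic 0) (adjacent (3 + o))

    predecessor : ∀ j → T (suc j + (3 + o)) ≡ T j
    predecessor j = trans (cong T (sym (+-suc j (3 + o)))) (periodic j)

    behind : ∀ {i j} → 1 ≤ i → j ≤ 3 + o → j + 2 ≤ i + (4 + o)
    behind {suc i} _ j≤M = ≤-trans (+-monoˡ-≤ 2 j≤M)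
                             (≤-trans (≤-reflexive (+-comm (3 + o) 2)) (s≤s (m≤n+m (4 + o) i)))

    module _ (p : NSeg) {m m′ : ℕ} (m≤m′ : m ≤ m′)
             (avoid : ∀ j → m ≤ j → j ≤ m′ → ¬ Meets (T j) p)
             (rigid : IsPrm p ⊎ (∀ j → m ≤ j → j ≤ m′ → IsIvl (T j))) where

      staysOn : ∀ σ → On σ (T m) p → On σ (T m′) p
      staysOn σ start = go (≤⇒≤′ m≤m′) ≤-refl
        where
        step : ∀ {k} → m ≤ k → k < m′ → On σ (T k) p → On σ (T (suc k)) p
        step {k} m≤k k<m′ on-k with separateOn σ (T (suc k)) p (avoid (suc k) (m≤n⇒m≤1+n m≤k) k<m′)
        ... | inj₁ on  = on
        ... | inj₂ off = ⊥-elim (crossOn σ (T k) (T (suc k)) p crossable (adjacent k) on-k off)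
          where
          crossable : IsPrm p ⊎ (IsIvl (T k) × IsIvl (T (suc k)))
          crossable = Sum.map₂ (λ ivls → ivls k m≤k (<⇒≤ k<m′) , ivls (suc k) (m≤n⇒m≤1+n m≤k) k<m′) rigid

        go : ∀ {k} → m ≤′ k → k ≤ m′ → On σ (T k) p
        go ≤′-refl _ = start
        go (≤′-step m≤′k) k<m′ = step (≤′⇒≤ m≤′k) k<m′ (go m≤′k (<⇒≤ k<m′))

      staysOn-back : ∀ σ → On σ (T m′) p → On σ (T m) p
      staysOn-back σ end with separateOn σ (T m) p (avoid m ≤-refl m≤m′)
      ... | inj₁ on  = on
      ... | inj₂ off = ⊥-elim (On-asym σ (T m′) p end (staysOn (flip σ) off))

    -- No permutation segment sits between two interval neighbours: the two intervals
    -- would meet although they are two steps apart.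
    noIPI : ∀ m → IsIvl (T m) → IsPrm (T (suc m)) → IsIvl (T (2 + m)) → ⊥
    noIPI m i₀ p₁ i₂ =
      distant (≤-reflexive (+-comm m 2))
              (≤-trans (≤-reflexive (trans (+-comm (2 + m) 2) (+-comm 4 m))) (+-monoʳ-≤ m (m≤m+n 4 o)))
              (ivl-prm-ivl _ _ _ i₀ p₁ i₂ (adjacent m) (adjacent (suc m)))

    -- Interval graphs have no chordless cycle of length ≥ 4. With T(0) as pivot, the
    -- stretch T(2), ..., T(2 + o) lies on one side σ of T(0); then T(1) and T(3 + o)
    -- both pass through the edge of T(0) facing σ, so they meet.
    notAllIntervals : ¬ (∀ m → m < 4 + o → IsIvl (T m))
    notAllIntervals ivls =
      [ onSide left , onSide right ]′ (separateOn left (T 2) (T 0) (avoid 2 ≤-refl (m≤m+n 2 o)))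
      where
      avoid : ∀ j → 2 ≤ j → j ≤ 2 + o → ¬ Meets (T j) (T 0)
      avoid j 2≤j j≤2+o = distant′ 2≤j (≤-trans (+-monoˡ-≤ 2 j≤2+o) (≤-reflexive (+-comm (2 + o) 2)))

      interval : ∀ {j} → j ≤ 3 + o → IsIvl (T j)
      interval j≤M = ivls _ (s≤s j≤M)

      onSide : ∀ σ → On σ (T 2) (T 0) → ⊥
      onSide σ s₂ = distant {1} {3 + o} (m≤m+n 3 o) (≤-reflexive (+-comm (3 + o) 2))
                      (common-point (T 1) (T (3 + o)) edge₁ edgeM)
        where
        s₂₊ₒ : On σ (T (2 + o)) (T 0)
        s₂₊ₒ = staysOn (T 0) (m≤m+n 2 o) avoid (inj₂ λ _ _ j≤2+o → interval (m≤n⇒m≤1+n j≤2+o)) σ s₂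
        edge₁ : Traces (T 1) (edge σ (T 0))
        edge₁ = meets-edge σ (T 1) (T 2) (T 0) (interval (s≤s z≤n)) (Meets-sym _ _ (adjacent 0)) (adjacent 1) s₂
        edgeM : Traces (T (3 + o)) (edge σ (T 0))
        edgeM = meets-edge σ (T (3 + o)) (T (2 + o)) (T 0) (interval ≤-refl) closing
                  (Meets-sym _ _ (adjacent (2 + o))) s₂₊ₒ

    -- Setting of `gap`: an interval arc T(0), ..., T(l′) whose complement l, ..., 3 + o
    -- has at least five positions. Joining q to p₀ avoiding p₁ and to p₁
    -- avoiding p₀ squeezes q between p₀ and p₁, which is impossible for either kind of q.
    module LongComplement {l′} (a : Arc o T 0 (suc l′)) (short : suc (suc l′) ≤ o) where
      l : ℕ
      l = suc l′

      p₀ p₁ q : NSeg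
      p₀ = T (3 + o)
      p₁ = T l
      q  = T (2 + l)

      q-far : (2 + l) + 2 ≤ 3 + o
      q-far = ≤-trans (≤-reflexive (+-comm (2 + l) 2)) (+-monoʳ-≤ 3 short)

      2+l≤M : 2 + l ≤ 3 + o
      2+l≤M = ≤-trans (m≤m+n (2 + l) 2) q-far

      p₀∤p₁ : ¬ Meets p₀ p₁
      p₀∤p₁ = distant′ (subst (_≤ 3 + o) (+-comm 2 l) 2+l≤M) (behind (s≤s z≤n) ≤-refl)

      avoid₁ : ∀ j → 2 + l ≤ j → j ≤ 3 + o → ¬ Meets (T j) p₁
      avoid₁ j 2+l≤j j≤M = distant′ (subst (_≤ j) (+-comm 2 l) 2+l≤j) (behind (s≤s z≤n) j≤M)

      avoid₀ : ∀ j → l ≤ j → j ≤ 2 + l → ¬ Meets (T j) p₀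
      avoid₀ j l≤j j≤2+l = distant (≤-trans (+-monoˡ-≤ 2 j≤2+l) q-far) (behind (≤-trans (s≤s z≤n) l≤j) ≤-refl)

      avoidᵠ : ∀ j → 3 + o ≤ j → j ≤ l + (4 + o) → ¬ Meets (T j) q
      avoidᵠ j M≤j j≤ = distant′ (≤-trans q-far M≤j)
                          (≤-trans (+-monoˡ-≤ 2 j≤) (≤-reflexive (+-comm (l + (4 + o)) 2)))

      avoidᵃ : ∀ j → 0 ≤ j → j ≤ l′ → ¬ Meets (T j) q
      avoidᵃ j _ j≤l′ = distant (≤-trans (+-monoˡ-≤ 2 (m≤n⇒m≤1+n j≤l′)) (≤-reflexive (+-comm l 2)))
                                (≤-trans q-far (≤-trans (n≤1+n _) (m≤n+m _ j)))

      q-between : ∀ σ → On σ p₀ p₁ → On σ q p₁ × On (flip σ) q p₀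
      q-between σ s₀ = staysOn-back p₁ 2+l≤M avoid₁ (inj₁ (arc-after a)) σ s₀
                     , staysOn p₀ (m≤n+m l 2) avoid₀ (inj₁ (arc-before a)) (flip σ) (On-swap σ s₀)

      -- A permutation segment q would see p₀ and, via the arc, p₁ on the same side σ.
      q-not-permutation : ∀ σ → On σ q p₁ → On (flip σ) q p₀ → ¬ IsPrm q
      q-not-permutation σ q-σ q-flipσ prm-q = On-asym σ p₁ q p₁-σ (On-swap σ q-σ)
        where
        p₁-σ : On σ p₁ q
        p₁-σ = subst (λ w → On σ w q) (periodic l)
                 (staysOn q (≤-trans (n≤1+n _) (m≤n+m (4 + o) l)) avoidᵠ (inj₁ prm-q) σ (On-swap⁻ σ q-flipσ))

      -- An interval q has the arc on one side; the arc's end on that side lies beyond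
      -- the neighbour p₀ or p₁ it has to meet.
      q-not-interval : ∀ σ → On σ q p₁ → On (flip σ) q p₀ → ¬ IsIvl q
      q-not-interval σ q-σ q-flipσ _ = [ fromσ , fromFlipσ ]′ (separateOn σ (T 0) q (avoidᵃ 0 z≤n z≤n))
        where
        fromFlipσ : On (flip σ) (T 0) q → ⊥
        fromFlipσ h = On⇒¬Meets (flip σ) (T 0) p₀
                        (On-trans (flip σ) (T 0) q p₀ (arc-inner a 0 (s≤s z≤n)) h q-flipσ)
                        (Meets-sym _ _ closing)
        fromσ : On σ (T 0) q → ⊥
        fromσ h = On⇒¬Meets σ (T l′) p₁
                    (On-trans σ (T l′) q p₁ (arc-inner a l′ ≤-refl)
                       (staysOn q z≤n avoidᵃ (inj₂ λ j _ j≤l′ → arc-inner a j (s≤s j≤l′)) σ h) q-σ)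
                    (adjacent l′)

      impossible : ⊥
      impossible = [ onSide left , onSide right ]′ (separateOn left p₀ p₁ p₀∤p₁)
        where
        onSide : ∀ σ → On σ p₀ p₁ → ⊥
        onSide σ s₀ with q-between σ s₀ | isIvl? q
        ... | q-σ , q-flipσ | yes ivl-q = q-not-interval σ q-σ q-flipσ ivl-q
        ... | q-σ , q-flipσ | no ¬ivl-q = q-not-permutation σ q-σ q-flipσ (¬ivl⇒prm q ¬ivl-q)

    -- An interval arc leaves at most four positions to the rest of the cycle.
    gap : ∀ {l} → Arc o T 0 l → suc l ≤ o → ⊥
    gap {zero}   a _ with arc-nonempty a
    ... | ()
    gap {suc l′} a short = LongComplement.impossible a short

    -- By `gap`
    -- the outside positions are l, ..., 3 + o with 3 + o ≤ l + 3; the ends are the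
    -- arc's neighbours, and a middle position is next to one of them on its far side,
    -- so an interval there would complete a forbidden interval-permutation-interval run.
    arcComplement₀ : ∀ {l} → Arc o T 0 l → ∀ j → l ≤ j → j < 4 + o → IsPrm (T j)
    arcComplement₀ {zero} a _ _ _ with arc-nonempty a
    ... | ()
    arcComplement₀ {suc l′} a j l≤j j<N with suc (suc l′) ≤? o
    ... | yes short = ⊥-elim (gap a short)
    ... | no long with m≤n⇒m<n∨m≡n (s≤s⁻¹ j<N) | m≤n⇒m<n∨m≡n l≤j
    ...   | inj₂ refl | _         = arc-before a
    ...   | inj₁ _    | inj₂ refl = arc-after a
    ...   | inj₁ j<M  | inj₁ l<j with m≤n⇒m<n∨m≡n l<j
    ...     | inj₂ refl  = ¬ivl⇒prm _ (noIPI l′ (arc-inner a l′ ≤-refl) (arc-after a))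
    ...     | inj₁ 1+l<j = ¬ivl⇒prm _ λ ivl →
                noIPI j ivl (subst (IsPrm ∘ T) (sym j+1≡M) (arc-before a)) wrapsTo0
      where
      -- j is the position just before 3 + o, so 2 + j wraps around to 0
      j+1≡M : suc j ≡ 3 + o
      j+1≡M = ≤-antisym j<M (≤-trans (+-monoʳ-≤ 3 (≮⇒≥ long)) (s≤s 1+l<j))
      wrapsTo0 : IsIvl (T (2 + j))
      wrapsTo0 = subst IsIvl (sym (trans (cong (λ k → T (suc k)) j+1≡M) (periodic 0)))
                   (arc-inner a 0 (s≤s z≤n))

    -- Given the arc at 0, an arc starting at d < 4 + o starts at 0: T(d) is an interval,
    -- so d lies inside the arc at 0, and for d > 0 so does d - 1, which must however
    -- carry a permutation segment.
    startsAt₀ : ∀ {la d lb} → Arc o T 0 la → Arc o T d lb → d < 4 + o → d ≡ 0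
    startsAt₀ {d = zero}        a b _   = refl
    startsAt₀ {la} {suc d′} a b d<N with la ≤? suc d′
    ... | yes la≤d = ⊥-elim (ivl-prm-disjoint _ first (arcComplement₀ a (suc d′) la≤d d<N))
      where
      first : IsIvl (T (suc d′))
      first = subst IsIvl (cong T (+-identityʳ (suc d′))) (arc-inner b 0 (arc-nonempty b))
    ... | no d<la = ⊥-elim (ivl-prm-disjoint _ (arc-inner a d′ (<-trans (n<1+n d′) (≰⇒> d<la)))
                                                (subst IsPrm (predecessor d′) (arc-before b)))

  module Arcs {o} {T : ℕ → NSeg} (C : IsCycle o T) where
    open IsCycle C
    open CycleProperties C

    -- Some position carries a permutation segment, so an interval at i is preceded
    -- (walking forward from it) by a permutation-to-interval switch; the maximal run of
    -- intervals from there is an arc, ending before the wrap-around to the switch.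
    existence : ∀ {i} → IsIvl (T i) → ∃ λ st → ∃ λ l → Arc o T st l
    existence {i} ivl-i = suc j , l , arc
      where
      Ivl? : ∀ m → Dec (IsIvl (T m))
      Ivl? m = isIvl? (T m)

      somePrm : ∃ λ (f : Fin (4 + o)) → ¬ IsIvl (T (toℕ f))
      somePrm = ¬∀⟶∃¬ (4 + o) (λ f → IsIvl (T (toℕ f))) (λ f → Ivl? (toℕ f))
                  λ ivls → notAllIntervals λ m m<N → subst (IsIvl ∘ T) (toℕ-fromℕ< m<N) (ivls (fromℕ< m<N))

      switch : ∃ λ j → ¬ IsIvl (T j) × IsIvl (T (suc j))
      switch = transition Ivl? (proj₂ somePrm) (subst IsIvl (sym (periodic i)) ivl-i)
                 (≤-trans (<⇒≤ (toℕ<n (proj₁ somePrm))) (m≤n+m _ i))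

      j : ℕ
      j = proj₁ switch

      run : ∃ λ l → 1 ≤ l × (∀ m → m < l → IsIvl (T (suc j + m))) × ¬ IsIvl (T (suc j + l))
      run = longestRun Ivl? (3 + o) (proj₂ (proj₂ switch))
              (subst (¬_ ∘ IsIvl) (sym (predecessor j)) (proj₁ (proj₂ switch)))

      l : ℕ
      l = proj₁ run

      arc : Arc o T (suc j) l
      arc = record
        { arc-nonempty = proj₁ (proj₂ run)
        ; arc-inner    = proj₁ (proj₂ (proj₂ run))
        ; arc-before   = subst IsPrm (sym (predecessor j)) (¬ivl⇒prm _ (proj₁ (proj₂ switch)))
        ; arc-after    = ¬ivl⇒prm _ (proj₂ (proj₂ (proj₂ run)))
        }

    -- Renumbering from sa, the second arc starts within one turn of the first, so by
    -- startsAt₀ at the same position; arcs with equal starts have equal lengths.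
    uniqueness : ∀ {sa la sb lb} → sa < 4 + o → sb < 4 + o → Arc o T sa la → Arc o T sb lb →
                 sb ≡ sa × lb ≡ la
    uniqueness {sa} {la} {sb} {lb} sa<N sb<N a b =
      sb≡sa , Arc-length b (subst (λ s → Arc o T s la) (sym sb≡sa) a)
      where
      offset : ∃ λ d → d < 4 + o × (sa + d ≡ sb ⊎ sa + d ≡ sb + (4 + o))
      offset = cyclicOffset sa<N sb<N

      d : ℕ
      d = proj₁ offset

      align : sa + d ≡ sb ⊎ sa + d ≡ sb + (4 + o) → ∀ m → T (sb + m) ≡ T (sa + (d + m))
      align (inj₁ e) m = cong T (trans (cong (_+ m) (sym e)) (+-assoc sa d m))
      align (inj₂ e) m = begin
        T (sb + m)              ≡⟨ sym (periodic (sb + m)) ⟩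
        T ((sb + m) + (4 + o))  ≡⟨ cong T (+-assoc sb m (4 + o)) ⟩
        T (sb + (m + (4 + o)))  ≡⟨ cong (λ k → T (sb + k)) (+-comm m (4 + o)) ⟩
        T (sb + ((4 + o) + m))  ≡⟨ cong T (sym (+-assoc sb (4 + o) m)) ⟩
        T ((sb + (4 + o)) + m)  ≡⟨ cong (λ k → T (k + m)) (sym e) ⟩
        T ((sa + d) + m)        ≡⟨ cong T (+-assoc sa d m) ⟩
        T (sa + (d + m))        ∎
        where open ≡-Reasoning

      d≡0 : d ≡ 0
      d≡0 = CycleProperties.startsAt₀ (shift C sa) (Arc-transport (λ _ → refl) a)
              (Arc-transport (align (proj₂ (proj₂ offset))) b) (proj₁ (proj₂ offset))

      startFromOffset : ∀ {e} → e ≡ 0 → sa + e ≡ sb ⊎ sa + e ≡ sb + (4 + o) → sb ≡ sa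
      startFromOffset refl (inj₁ e) = trans (sym e) (+-identityʳ sa)
      startFromOffset refl (inj₂ e) = ⊥-elim (<-irrefl refl
        (≤-trans sa<N (≤-trans (m≤n+m _ sb) (≤-reflexive (trans (sym e) (+-identityʳ sa))))))

      sb≡sa : sb ≡ sa
      sb≡sa = startFromOffset d≡0 (proj₂ (proj₂ offset))

-- Reflecting the plane in the line y = 3/2 when all interval segments lie on L₂
-- moves them to L₁; intersections and kinds of segments are unchanged.
module Normalize {c ℓ₁ ℓ₂ : Level} (O : TotalOrder c ℓ₁ ℓ₂) where
  open Geometry O
  open TotalOrder O renaming (_≤_ to _≼_) using ()

  normalize : (l : Line) (u : Seg O) → OnLineOrPerm O l u → NSeg
  normalize l  (ival .l a b a≼b) refl = ivl a b a≼b
  normalize L₁ (perm x y)        _    = prm x y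
  normalize L₂ (perm x y)        _    = prm y x

  reflect : ∀ {x y x′ y′} →
    ((x ≼ x′) × (y′ ≼ y)) ⊎ ((x′ ≼ x) × (y ≼ y′)) → ((y ≼ y′) × (x′ ≼ x)) ⊎ ((y′ ≼ y) × (x ≼ x′))
  reflect = swap ∘ Sum.map ×-swap ×-swap

  normalize-meets : ∀ l u v ou ov → Intersect O u v ⇔ Meets (normalize l u ou) (normalize l v ov)
  normalize-meets L₁ (ival _ _ _ _) (ival _ _ _ _) refl refl = mk⇔ id id
  normalize-meets L₂ (ival _ _ _ _) (ival _ _ _ _) refl refl = mk⇔ id id
  normalize-meets L₁ (ival _ _ _ _) (perm _ _)     refl _    = mk⇔ id id
  normalize-meets L₂ (ival _ _ _ _) (perm _ _)     refl _    = mk⇔ id id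
  normalize-meets L₁ (perm _ _)     (ival _ _ _ _) _    refl = mk⇔ id id
  normalize-meets L₂ (perm _ _)     (ival _ _ _ _) _    refl = mk⇔ id id
  normalize-meets L₁ (perm _ _)     (perm _ _)     _    _    = mk⇔ id id
  normalize-meets L₂ (perm _ _)     (perm _ _)     _    _    = mk⇔ reflect reflect

  normalize-interval : ∀ l u ou → IsInterval O u ⇔ IsIvl (normalize l u ou)
  normalize-interval l  (ival .l _ _ _) refl = mk⇔ id id
  normalize-interval L₁ (perm _ _)      _    = mk⇔ id id
  normalize-interval L₂ (perm _ _)      _    = mk⇔ id id

  normalize-permutation : ∀ l u ou → IsPermutation O u ⇔ IsPrm (normalize l u ou)
  normalize-permutation l  (ival .l _ _ _) refl = mk⇔ id id
  normalize-permutation L₁ (perm _ _)      _    = mk⇔ id id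
  normalize-permutation L₂ (perm _ _)      _    = mk⇔ id id

module Modular (n : ℕ) .{{_ : NonZero n}} where

  toℕ-at : ∀ a → toℕ (at n a) ≡ a % n
  toℕ-at a = toℕ-fromℕ< _

  at-cong : ∀ {a b} → a % n ≡ b % n → at n a ≡ at n b
  at-cong e = toℕ-injective (trans (toℕ-at _) (trans e (sym (toℕ-at _))))

  at-toℕ : ∀ i → at n (toℕ i) ≡ i
  at-toℕ i = toℕ-injective (trans (toℕ-at _) (m<n⇒m%n≡m (toℕ<n i)))

  at-periodic : ∀ a → at n (a + n) ≡ at n a
  at-periodic a = at-cong ([m+n]%n≡m%n a n)

  %-absorb : ∀ a m → (a % n + m) % n ≡ (a + m) % n
  %-absorb a m = begin
    (a % n + m) % n            ≡⟨ %-distribˡ-+ (a % n) m n ⟩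
    (a % n % n + m % n) % n    ≡⟨ cong (λ k → (k + m % n) % n) (m%n%n≡m%n a n) ⟩
    (a % n + m % n) % n        ≡⟨ sym (%-distribˡ-+ a m n) ⟩
    (a + m) % n                ∎
    where open ≡-Reasoning

  at-reduce : ∀ a m → at n (toℕ (at n a) + m) ≡ at n (a + m)
  at-reduce a m = at-cong (trans (cong (λ k → (k + m) % n) (toℕ-at a)) (%-absorb a m))

  at-suc : ∀ a → at n (suc (toℕ (at n a))) ≡ at n (suc a)
  at-suc a = trans (cong (at n) (+-comm 1 _)) (trans (at-reduce a 1) (cong (at n) (+-comm a 1)))

  %-window : ∀ {r d} → r < n → 0 < d → d < n → (r + d) % n ≢ r
  %-window {r} {d} r<n 0<d d<n eq with r + d <? n
  ... | yes r+d<n = <⇒≢ (m<m+n r 0<d) (sym (trans (sym (m<n⇒m%n≡m r+d<n)) eq))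
  ... | no  r+d≮n = <⇒≢ d<n (+-cancelˡ-≡ r d n (trans (sym (m∸n+n≡m n≤r+d)) (cong (_+ n) wrapped≡r)))
    where
    n≤r+d : n ≤ r + d
    n≤r+d = ≮⇒≥ r+d≮n
    wrapped≡r : r + d ∸ n ≡ r
    wrapped≡r = begin
      r + d ∸ n          ≡⟨ sym (m<n⇒m%n≡m (m<n+o⇒m∸n<o (r + d) n (+-mono-< r<n d<n))) ⟩
      (r + d ∸ n) % n    ≡⟨ m≤n⇒[n∸m]%m≡n%m n≤r+d ⟩
      (r + d) % n        ≡⟨ eq ⟩
      r                  ∎
      where open ≡-Reasoning

  at-distinct : ∀ {a b} → a < b → b < a + n → at n a ≢ at n b
  at-distinct {a} {b} a<b b<a+n eq = %-window (m%n<n a n) (m<n⇒0<n∸m a<b) (m<n+o⇒m∸n<o b a b<a+n) (begin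
    (a % n + (b ∸ a)) % n   ≡⟨ %-absorb a (b ∸ a) ⟩
    (a + (b ∸ a)) % n       ≡⟨ cong (_% n) (m+[n∸m]≡n (<⇒≤ a<b)) ⟩
    b % n                   ≡⟨ sym (toℕ-at b) ⟩
    toℕ (at n b)            ≡⟨ cong toℕ (sym eq) ⟩
    toℕ (at n a)            ≡⟨ toℕ-at a ⟩
    a % n                   ∎)
    where open ≡-Reasoning

module FromModel {c ℓ₁ ℓ₂ : Level} (O : TotalOrder c ℓ₁ ℓ₂) (o : ℕ) (s : Fin (4 + o) → Seg O)
                 (model : IsCycleModel O (4 + o) s) (l : Line) (on : ∀ i → OnLineOrPerm O l (s i)) where
  open Geometry O
  open Geometry.Arc
  open Normalize O
  open Modular (4 + o)
  open Equivalence using (to; from)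

  t : Fin (4 + o) → NSeg
  t i = normalize l (s i) (on i)

  T : ℕ → NSeg
  T m = t (at (4 + o) m)

  meets⇒adjacent : ∀ a b → at (4 + o) a ≢ at (4 + o) b → Meets (T a) (T b) →
                   CycleAdj (4 + o) (at (4 + o) a) (at (4 + o) b)
  meets⇒adjacent a b ne m = to (model _ _ ne) (from (normalize-meets l _ _ (on _) (on _)) m)

  adjacent⇒meets : ∀ a b → at (4 + o) a ≢ at (4 + o) b →
                   CycleAdj (4 + o) (at (4 + o) a) (at (4 + o) b) → Meets (T a) (T b)
  adjacent⇒meets a b ne adj = to (normalize-meets l _ _ (on _) (on _)) (from (model _ _ ne) adj)

  isCycle : IsCycle o T
  isCycle = record
    { periodic = λ m → cong t (at-periodic m)
    ; adjacent = λ m → adjacent⇒meets m (suc m) (at-distinct {m} (n<1+n m) (2+m≤m+n m)) (inj₁ (sym (at-suc m)))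
    ; distant  = distant
    }
    where
    2+m≤m+n : ∀ m → 2 + m ≤ m + (4 + o)
    2+m≤m+n m = ≤-trans (≤-reflexive (+-comm 2 m)) (+-monoʳ-≤ m (m≤m+n 2 (2 + o)))

    distant : ∀ {i j} → i + 2 ≤ j → j + 2 ≤ i + (4 + o) → ¬ Meets (T i) (T j)
    distant {i} {j} i+2≤j j+2≤i+n m = notAdjacent (meets⇒adjacent i j (at-distinct {i} i<j j<i+n) m)
      where
      i<j : i < j
      i<j = <-≤-trans (m<m+n i z<s) i+2≤j
      j<i+n : j < i + (4 + o)
      j<i+n = <-≤-trans (m<m+n j z<s) j+2≤i+n

      notAdjacent : ¬ CycleAdj (4 + o) (at (4 + o) i) (at (4 + o) j)
      notAdjacent (inj₁ e) = at-distinct {suc i} (subst (_≤ j) (+-comm i 2) i+2≤j)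
                               (<-≤-trans (m<m+n j z<s) (≤-trans j+2≤i+n (n≤1+n _)))
                               (trans (sym (at-suc i)) (sym e))
      notAdjacent (inj₂ e) = at-distinct {suc j} (subst (_≤ i + (4 + o)) (+-comm j 2) j+2≤i+n)
                               (+-monoˡ-< (4 + o) (s≤s (≤-trans (m≤m+n i 2) i+2≤j)))
                               (trans (sym (at-suc j)) (trans (sym e) (sym (at-periodic i))))

  fromIntervalArc : (b : IntervalArc O (4 + o) s) → Arc o T (toℕ (start b)) (len b)
  fromIntervalArc b = record
    { arc-nonempty = nonempty b
    ; arc-inner    = λ m m<l → to (normalize-interval l _ (on _)) (inner b m m<l)
    ; arc-before   = to (normalize-permutation l _ (on _)) (before b)
    ; arc-after    = to (normalize-permutation l _ (on _)) (after b)
    }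

  toIntervalArc : ∀ {st len} → Arc o T st len → IntervalArc O (4 + o) s
  toIntervalArc {st} {len} a = record
    { start    = at (4 + o) st
    ; len      = len
    ; nonempty = arc-nonempty a
    ; inner    = λ m m<l → from (normalize-interval l _ (on _)) (reduced IsIvl m (arc-inner a m m<l))
    ; before   = from (normalize-permutation l _ (on _)) (reduced IsPrm (3 + o) (arc-before a))
    ; after    = from (normalize-permutation l _ (on _)) (reduced IsPrm len (arc-after a))
    }
    where
    reduced : ∀ (P : NSeg → Set) m → P (T (st + m)) → P (t (at (4 + o) (toℕ (at (4 + o) st) + m)))
    reduced P m = subst (P ∘ t) (sym (at-reduce st m))

  exactlyOneArc : ∀ i → IsInterval O (s i) → ExactlyOneArc O (4 + o) s
  exactlyOneArc i ivl-i = arc , λ b → unique b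
    where
    open Arcs isCycle

    found : ∃ λ st → ∃ λ len → Arc o T st len
    found = existence {toℕ i} (subst (IsIvl ∘ t) (sym (at-toℕ i)) (to (normalize-interval l _ (on i)) ivl-i))

    arc : IntervalArc O (4 + o) s
    arc = toIntervalArc (proj₂ (proj₂ found))

    unique : ∀ b → (start b ≡ start arc) × (len b ≡ len arc)
    unique b = toℕ-injective (proj₁ same) , proj₂ same
      where
      same : toℕ (start b) ≡ toℕ (start arc) × len b ≡ len arc
      same = uniqueness (toℕ<n (start arc)) (toℕ<n (start b)) (fromIntervalArc arc) (fromIntervalArc b)

lemma3 : ∀ {c ℓ₁ ℓ₂ : Level} (O : TotalOrder c ℓ₁ ℓ₂) (n : ℕ) .{{_ : NonZero n}} →
    4 ≤ n → (s : Fin n → Seg O) →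
    IsCycleModel O n s → IsStar O n s → (∃ λ i → IsInterval O (s i)) →
    ExactlyOneArc O n s
lemma3 O n 4≤n s model (l , on) (i , ivl-i) with m≤n⇒∃[o]m+o≡n 4≤n
... | o , refl = FromModel.exactlyOneArc O o s model l on i ivl-i
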